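{- If $T$ is a caterpillar, then $\chi_{\mathrm{cen}}(T)\leq\chi_{\mathrm{lin}}(T)+1$. Furthermore, there exist caterpillars $T$ with $\chi_{\mathrm{cen}}(T)=\chi_{\mathrm{lin}}(T)+1$.
   Context: A caterpillar is a tree such that removing all its leaves yields a path. A centered coloring of a graph $G$ assigns integers (colors) to vertices so that every connected subgraph contains a vertex whose color is unique in that subgraph; $\chi_{\mathrm{cen}}(G)$ is the minimum number of colors of such a coloring. A linear coloring requires the same only for every path of $G$ (as a subgraph); $\chi_{\mathrm{lin}}(G)$ is the minimum number of colors of a linear coloring. -}

module Defs where

open import Data.Nat using (ℕ; zero; suc; _≤_; _+_)
open import Data.Bool using (Bool; true; false; T; if_then_else_)
open import Data.Fin using (Fin; toℕ)
open import Data.List using (List; []; _∷_; _++_; length; lookup; map; allFin)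
open import Data.Nat.ListAction using (sum)
open import Data.Unit using (⊤)
open import Data.List.Membership.Propositional using (_∈_)
open import Data.List.Relation.Unary.Unique.Propositional using (Unique)
open import Data.Product using (Σ; ∃; _×_; _,_)
open import Data.Sum using (_⊎_)
open import Relation.Binary.PropositionalEquality using (_≡_; _≢_)
open import Relation.Nullary using (¬_)
open import Function.Bundles using (_⇔_)

record Graph (n : ℕ) : Set where
  field
    adj   : Fin n → Fin n → Bool
    sym   : ∀ u v → adj u v ≡ adj v u
    irrefl : ∀ u → adj u u ≡ false

open Graph public

module _ {n : ℕ} (G : Graph n) where

  Adj : Fin n → Fin n → Set
  Adj u v = T (adj G u v)

  Chain : List (Fin n) → Set
  Chain []           = ⊤
  Chain (x ∷ [])     = ⊤
  Chain (x ∷ y ∷ xs) = Adj x y × Chain (y ∷ xs)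

  data WalkIn (P : Fin n → Set) : Fin n → Fin n → Set where
    here : ∀ {u} → P u → WalkIn P u u
    step : ∀ {u w v} → P u → Adj u w → WalkIn P w v → WalkIn P u v

  ConnectedOn : (Fin n → Bool) → Set
  ConnectedOn S = (∃ λ v → T (S v))
                × (∀ u v → T (S u) → T (S v) → WalkIn (λ x → T (S x)) u v)

  Connected : Set
  Connected = ConnectedOn (λ _ → true)

  IsPath : List (Fin n) → Set
  IsPath xs = (1 ≤ length xs) × Unique xs × Chain xs

  HasCycle : Set
  HasCycle = Σ (Fin n) λ x → Σ (List (Fin n)) λ ys → Σ (Fin n) λ z →
    let cyc = x ∷ (ys ++ (z ∷ [])) in
    (1 ≤ length ys) × Unique cyc × Chain cyc × Adj z x

  IsTree : Set
  IsTree = (1 ≤ n) × Connected × ¬ HasCycle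

  degree : Fin n → ℕ
  degree u = sum (map (λ v → if adj G u v then 1 else 0) (allFin n))

  IsLeaf : Fin n → Set
  IsLeaf u = degree u ≡ 1

  -- the subgraph induced by the non-leaf vertices is a path graph
  -- (the empty graph counts as the path on 0 vertices): there is an
  -- enumeration without repetition of the non-leaves such that two of them
  -- are adjacent iff they are consecutive in the enumeration.
  NonLeavesFormPath : Set
  NonLeavesFormPath = Σ (List (Fin n)) λ vs →
      Unique vs
    × (∀ v → (v ∈ vs) ⇔ (¬ IsLeaf v))
    × (∀ i j → Adj (lookup vs i) (lookup vs j)
                 ⇔ ((toℕ i ≡ suc (toℕ j)) ⊎ (toℕ j ≡ suc (toℕ i))))

  IsCaterpillar : Set
  IsCaterpillar = IsTree × NonLeavesFormPath

  -- centered coloring using (at most) k colors: every connected subgraph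
  -- (equivalently every nonempty vertex set inducing a connected subgraph)
  -- has a vertex whose color is unique in it
  IsCenteredColoring : (k : ℕ) → (Fin n → Fin k) → Set
  IsCenteredColoring k c = ∀ (S : Fin n → Bool) → ConnectedOn S →
    ∃ λ v → T (S v) × (∀ w → T (S w) → c w ≡ c v → w ≡ v)

  IsLinearColoring : (k : ℕ) → (Fin n → Fin k) → Set
  IsLinearColoring k c = ∀ (xs : List (Fin n)) → IsPath xs →
    ∃ λ v → v ∈ xs × (∀ w → w ∈ xs → c w ≡ c v → w ≡ v)

  HasCenteredColoring : ℕ → Set
  HasCenteredColoring k = ∃ λ (c : Fin n → Fin k) → IsCenteredColoring k c

  HasLinearColoring : ℕ → Set
  HasLinearColoring k = ∃ λ (c : Fin n → Fin k) → IsLinearColoring k c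

IsMinimum : (ℕ → Set) → ℕ → Set
IsMinimum P k = P k × (∀ j → P j → k ≤ j)

IsChiCen : ∀ {n} → Graph n → ℕ → Set
IsChiCen G = IsMinimum (HasCenteredColoring G)

IsChiLin : ∀ {n} → Graph n → ℕ → Set
IsChiLin G = IsMinimum (HasLinearColoring G)

{-# OPTIONS --safe #-}
module Submission where

open import Defs
open import Data.Nat using (ℕ; zero; suc; _≤_; _<_; _+_; z≤n; s≤s; _≤?_)
open import Data.Nat.Properties as ℕₚ
  using ( ≤-trans; ≤-reflexive; m≤m+n; m≤n+m; +-monoʳ-≤; +-comm; +-identityʳ; +-suc
        ; <⇒≱; <-asym; <-trans; ≰⇒>; ≤-pred; m+[n∸m]≡n)
open import Data.Nat.ListAction using (sum)
open import Data.Bool using (Bool; true; false; T; if_then_else_; _∨_)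
open import Data.Bool.Properties as Boolₚ using (∨-comm)
open import Data.Fin using (Fin; zero; suc; toℕ; _↑ˡ_; _↑ʳ_; splitAt; fromℕ<)
open import Data.Fin.Properties as Finₚ
  using (↑ˡ-injective; splitAt-↑ˡ; splitAt-↑ʳ; inject≤-injective; punchOut-injective; toℕ-fromℕ<)
open import Data.List
  using ( List; []; _∷_; _++_; [_]; _∷ʳ_; length; lookup; map; filter; concatMap; allFin
        ; takeWhile; dropWhile; head; last)
open import Data.List.Properties using (takeWhile++dropWhile; ++-assoc)
open import Data.List.Membership.Propositional using (_∈_; _∉_; find)
import Data.List.Membership.DecPropositional as DecMembership
open import Data.List.Membership.Propositional.Properties
  using (∈-++⁺ˡ; ∈-++⁺ʳ; ∈-++⁻; ∈-allFin; ∈-map⁺; ∈-filter⁺; ∈-concatMap⁺)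
open import Data.List.Relation.Unary.Any as Any using (Any; here; there; any?)
open import Data.List.Relation.Unary.Any.Properties using (lookup-index)
open import Data.List.Relation.Unary.All as All using (All; []; _∷_; all?)
open import Data.List.Relation.Unary.All.Properties
  using (All¬⇒¬Any; all-takeWhile; all-head-dropWhile; ++⁻ˡ; ++⁻ʳ)
open import Data.List.Relation.Unary.Unique.Propositional using (Unique)
open import Data.List.Relation.Unary.AllPairs using ([]; _∷_; allPairs?)
open import Data.Maybe using (just; maybe′)
import Data.Maybe.Relation.Unary.All as Maybe
open import Data.Product using (Σ; ∃; ∃₂; _×_; _,_; proj₁; proj₂; uncurry)
open import Data.Sum using (_⊎_; inj₁; inj₂)
open import Data.Unit using (⊤; tt)
open import Data.Empty using (⊥; ⊥-elim)
open import Function using (_∘_)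
open import Function.Bundles using (_⇔_; mk⇔; Equivalence)
open import Function.Definitions using (Injective)
open import Relation.Binary.Definitions using (DecidableEquality)
open import Relation.Binary.PropositionalEquality as ≡ using (_≡_; _≢_; refl; cong; subst; subst₂; trans)
open import Relation.Nullary using (¬_; Dec; yes; no; contradiction)
open import Relation.Nullary.Decidable
  using (T?; isYes; True; toWitness; fromWitness; map′; ¬?; _×-dec_; _⊎-dec_; _→-dec_)
open import Relation.Unary using (Pred; Decidable; ∁)
open import Level using (0ℓ)

-- Color the spine (the non-leaves) by a linear coloring and give all leaves one new color.
-- A connected set S meeting the spine meets it in a contiguous run: a spine vertex y ∉ S cuts
-- the caterpillar, since from one side of y a walk can only reach that side of the spine and
-- the leaves hanging off it. The run is a path, so it has a vertex whose color is unique on it,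
-- and no leaf shares that color. A connected set of leaves is a single vertex, or an edge when
-- the whole tree is that edge; then the spine is empty and nobody gets the new color.
-- For sharpness take the comb: a spine v0 v1 v2 v3 with one leaf on each spine vertex. It has
-- a linear 3-coloring but no linear 2-coloring, its spine being a path on four vertices.
-- A centered coloring uses some color at a single vertex r only, and r misses one of the
-- disjoint paths leaf-v0-v1-leaf and leaf-v2-v3-leaf; with three colors that path on four
-- vertices would be colored from the two remaining colors, leaving none of its colors unique.

module _ {A : Set} where

  sum-map-≥ : (f : A → ℕ) {a : A} (xs : List A) → a ∈ xs → f a ≤ sum (map f xs)
  sum-map-≥ f (x ∷ xs) (here refl) = m≤m+n (f x) _
  sum-map-≥ f (x ∷ xs) (there a∈) = ≤-trans (sum-map-≥ f xs a∈) (m≤n+m _ (f x))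

  sum-map-≥-pair : (f : A → ℕ) {a b : A} (xs : List A) → a ≢ b → a ∈ xs → b ∈ xs →
                   f a + f b ≤ sum (map f xs)
  sum-map-≥-pair f (x ∷ xs) a≢b (here refl) (here refl) = contradiction refl a≢b
  sum-map-≥-pair f (x ∷ xs) a≢b (here refl) (there b∈) = +-monoʳ-≤ (f x) (sum-map-≥ f xs b∈)
  sum-map-≥-pair f {a} (x ∷ xs) a≢b (there a∈) (here refl) =
    ≤-trans (≤-reflexive (+-comm (f a) (f x))) (+-monoʳ-≤ (f x) (sum-map-≥ f xs a∈))
  sum-map-≥-pair f (x ∷ xs) a≢b (there a∈) (there b∈) =
    ≤-trans (sum-map-≥-pair f xs a≢b a∈ b∈) (m≤n+m _ (f x))

  Unique-++⁻ˡ : ∀ (xs : List A) {ys} → Unique (xs ++ ys) → Unique xs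
  Unique-++⁻ˡ []       _          = []
  Unique-++⁻ˡ (x ∷ xs) {ys} (x∉ ∷ uq) = ++⁻ˡ xs {ys} x∉ ∷ Unique-++⁻ˡ xs uq

  Unique-++⁻ʳ : ∀ (xs : List A) {ys} → Unique (xs ++ ys) → Unique ys
  Unique-++⁻ʳ []       uq       = uq
  Unique-++⁻ʳ (x ∷ xs) (_ ∷ uq) = Unique-++⁻ʳ xs uq

  Unique-++-disjoint : ∀ (xs : List A) {ys} {a : A} → Unique (xs ++ ys) → a ∈ xs → a ∈ ys → ⊥
  Unique-++-disjoint (x ∷ xs) {ys} (x∉ ∷ _) (here refl) a∈ys = All.lookup (++⁻ʳ xs {ys} x∉) a∈ys refl
  Unique-++-disjoint (x ∷ xs) (_ ∷ uq) (there a∈xs) a∈ys = Unique-++-disjoint xs uq a∈xs a∈ys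

  last-∷ʳ : ∀ (xs : List A) x → last (xs ∷ʳ x) ≡ just x
  last-∷ʳ []           x = refl
  last-∷ʳ (y ∷ [])     x = refl
  last-∷ʳ (y ∷ z ∷ zs) x = last-∷ʳ (z ∷ zs) x

  index-in-prefix : ∀ {a} (xs ys : List A) → a ∈ xs →
                    ∃ λ i → lookup (xs ++ ys) i ≡ a × toℕ i < length xs
  index-in-prefix (x ∷ xs) ys (here refl) = zero , refl , s≤s z≤n
  index-in-prefix (x ∷ xs) ys (there a∈) with index-in-prefix xs ys a∈
  ... | i , eq , i< = suc i , eq , s≤s i<

  index-in-suffix : ∀ {a} (xs : List A) y ys → a ∈ ys →
                    ∃ λ j → lookup (xs ++ y ∷ ys) j ≡ a × length xs < toℕ j
  index-in-suffix []       y ys a∈ = suc (Any.index a∈) , ≡.sym (lookup-index a∈) , s≤s z≤n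
  index-in-suffix (x ∷ xs) y ys a∈ with index-in-suffix xs y ys a∈
  ... | j , eq , <j = suc j , eq , s≤s <j

  module _ {P : Pred A 0ℓ} (P? : Decidable P) where

    record FirstRun (xs : List A) : Set where
      field
        before     : List A
        first      : A
        rest       : List A
        after      : List A
        split      : xs ≡ before ++ (first ∷ rest) ++ after
        before-∁P  : All (∁ P) before
        run-P      : All P (first ∷ rest)
        after-head : Maybe.All (∁ P) (head after)

    first-run : ∀ xs → Any P xs → FirstRun xs
    first-run (x ∷ xs) p with P? x
    ... | yes px = record
      { before = [] ; first = x ; rest = takeWhile P? xs ; after = dropWhile P? xs
      ; split = cong (x ∷_) (≡.sym (takeWhile++dropWhile P? xs))
      ; before-∁P = [] ; run-P = px ∷ all-takeWhile P? xs ; after-head = all-head-dropWhile P? xs }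
    ... | no ¬px = record
      { before = x ∷ before ; first = first ; rest = rest ; after = after
      ; split = cong (x ∷_) split
      ; before-∁P = ¬px ∷ before-∁P ; run-P = run-P ; after-head = after-head }
      where open FirstRun (first-run xs (Any.tail ¬px p))

-- Colorings

↑ˡ≢↑ʳ : ∀ {m n} (i : Fin m) (j : Fin n) → i ↑ˡ n ≢ m ↑ʳ j
↑ˡ≢↑ʳ {m} {n} i j eq with trans (≡.sym (splitAt-↑ˡ m i n)) (trans (cong (splitAt m) eq) (splitAt-↑ʳ m n j))
... | ()

freshOutside : ∀ {n b} {K : Fin n → Set} → Decidable K → (Fin n → Fin b) → Fin n → Fin (b + 1)
freshOutside {b = b} K? c x with K? x
... | yes _ = c x ↑ˡ 1
... | no  _ = b ↑ʳ zero

module _ {n b} {K : Fin n → Set} (K? : Decidable K) (c : Fin n → Fin b) where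

  freshOutside-inside : ∀ {x} → K x → freshOutside K? c x ≡ c x ↑ˡ 1
  freshOutside-inside {x} Kx with K? x
  ... | yes _  = refl
  ... | no ¬Kx = contradiction Kx ¬Kx

  freshOutside-outside : ∀ {x} → ¬ K x → freshOutside K? c x ≡ b ↑ʳ zero
  freshOutside-outside {x} ¬Kx with K? x
  ... | yes Kx = contradiction Kx ¬Kx
  ... | no _   = refl

alternate₂ : {x y z : Fin 2} → x ≢ y → y ≢ z → x ≡ z
alternate₂ {zero}     {zero}     x≢y _   = contradiction refl x≢y
alternate₂ {suc zero} {suc zero} x≢y _   = contradiction refl x≢y
alternate₂ {_} {zero}     {zero}     _ y≢z = contradiction refl y≢z
alternate₂ {_} {suc zero} {suc zero} _ y≢z = contradiction refl y≢z
alternate₂ {zero}     {suc zero} {zero}     _ _ = refl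
alternate₂ {suc zero} {zero}     {suc zero} _ _ = refl

alternate₃-avoiding : {α x y z : Fin 3} → α ≢ x → α ≢ y → α ≢ z → x ≢ y → y ≢ z → x ≡ z
alternate₃-avoiding α≢x α≢y α≢z x≢y y≢z = punchOut-injective α≢x α≢z
  (alternate₂ (x≢y ∘ punchOut-injective α≢x α≢y) (y≢z ∘ punchOut-injective α≢y α≢z))

upward-closed-fails⇒< : {P : ℕ → Set} → (∀ {i j} → i ≤ j → P i → P j) → ∀ {k j} → ¬ P k → P j → k < j
upward-closed-fails⇒< up {k} {j} ¬Pk Pj with j ≤? k
... | yes j≤k = contradiction (up j≤k Pj) ¬Pk
... | no  j≰k = ≰⇒> j≰k

UniqueColorIn : {A C : Set} → (A → C) → List A → Set
UniqueColorIn c xs = ∃ λ v → v ∈ xs × (∀ w → w ∈ xs → c w ≡ c v → w ≡ v)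

uniqueColorIn? : {A C : Set} → DecidableEquality A → DecidableEquality C →
                 (c : A → C) → Decidable (UniqueColorIn c)
uniqueColorIn? _≟ᴬ_ _≟ᶜ_ c xs =
  map′ witness candidate (any? (λ v → all? (λ w → (c w ≟ᶜ c v) →-dec (w ≟ᴬ v)) xs) xs)
  where
  witness : Any (λ v → All (λ w → c w ≡ c v → w ≡ v) xs) xs → UniqueColorIn c xs
  witness found with find found
  ... | v , v∈ , unique = v , v∈ , λ w w∈ → All.lookup unique w∈
  candidate : UniqueColorIn c xs → Any (λ v → All (λ w → c w ≡ c v → w ≡ v) xs) xs
  candidate (v , v∈ , unique) = Any.map (λ { refl → All.tabulate (unique _) }) v∈

alternating-P₄-no-unique : {A C : Set} {c : A → C} {a b d e : A} → a ≢ d → b ≢ e → c a ≡ c d → c b ≡ c e →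
                           ¬ UniqueColorIn c (a ∷ b ∷ d ∷ e ∷ [])
alternating-P₄-no-unique a≢d b≢e ad be (_ , here refl , unique) =
  a≢d (≡.sym (unique _ (there (there (here refl))) (≡.sym ad)))
alternating-P₄-no-unique a≢d b≢e ad be (_ , there (here refl) , unique) =
  b≢e (≡.sym (unique _ (there (there (there (here refl)))) (≡.sym be)))
alternating-P₄-no-unique a≢d b≢e ad be (_ , there (there (here refl)) , unique) =
  a≢d (unique _ (here refl) ad)
alternating-P₄-no-unique a≢d b≢e ad be (_ , there (there (there (here refl))) , unique) =
  b≢e (unique _ (there (here refl)) be)

-- Graphs

IsSingleton : ∀ {n} → (Fin n → Bool) → Set
IsSingleton S = ∃ λ v → T (S v) × ∀ w → T (S w) → w ≡ v

T⇒indicator≡1 : ∀ {b} → T b → (if b then 1 else 0) ≡ 1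
T⇒indicator≡1 {true} _ = refl

module _ {n : ℕ} (G : Graph n) where

  open DecMembership (Finₚ._≟_ {n}) using (_∈?_)

  Adj-sym : ∀ {u v} → Adj G u v → Adj G v u
  Adj-sym {u} {v} = subst T (sym G u v)

  Adj⇒≢ : ∀ {u v} → Adj G u v → u ≢ v
  Adj⇒≢ {u} uv refl = subst T (irrefl G u) uv

  edge-path : ∀ {u v} → Adj G u v → IsPath G (u ∷ v ∷ [])
  edge-path uv = s≤s z≤n , (Adj⇒≢ uv ∷ []) ∷ [] ∷ [] , uv , tt

  walk-start : ∀ {P u v} → WalkIn G P u v → P u
  walk-start (here Pu)     = Pu
  walk-start (step Pu _ _) = Pu

  _◅◅_ : ∀ {P u w v} → WalkIn G P u w → WalkIn G P w v → WalkIn G P u v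
  here _      ◅◅ q = q
  step Pu a p ◅◅ q = step Pu a (p ◅◅ q)

  walk-reverse : ∀ {P u v} → WalkIn G P u v → WalkIn G P v u
  walk-reverse (here Pu)     = here Pu
  walk-reverse (step Pu a p) = walk-reverse p ◅◅ step (walk-start p) (Adj-sym a) (here Pu)

  Chain-++⁻ˡ : ∀ xs {ys} → Chain G (xs ++ ys) → Chain G xs
  Chain-++⁻ˡ []           _          = tt
  Chain-++⁻ˡ (x ∷ [])     _          = tt
  Chain-++⁻ˡ (x ∷ y ∷ xs) (xy , ch) = xy , Chain-++⁻ˡ (y ∷ xs) ch

  Chain-tail : ∀ x xs → Chain G (x ∷ xs) → Chain G xs
  Chain-tail x []       _        = tt
  Chain-tail x (y ∷ xs) (_ , ch) = ch

  Chain-++⁻ʳ : ∀ xs {ys} → Chain G (xs ++ ys) → Chain G ys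
  Chain-++⁻ʳ []       ch = ch
  Chain-++⁻ʳ (x ∷ xs) ch = Chain-++⁻ʳ xs (Chain-tail x _ ch)

  consecutive⇒Chain : ∀ xs → (∀ i j → toℕ j ≡ suc (toℕ i) → Adj G (lookup xs i) (lookup xs j)) → Chain G xs
  consecutive⇒Chain []           _   = tt
  consecutive⇒Chain (x ∷ [])     _   = tt
  consecutive⇒Chain (x ∷ y ∷ xs) adj = adj zero (suc zero) refl
    , consecutive⇒Chain (y ∷ xs) (λ i j j≡1+i → adj (suc i) (suc j) (cong suc j≡1+i))

  chain-walk : ∀ {P x xs v} → Chain G (x ∷ xs) → All P (x ∷ xs) → v ∈ x ∷ xs → WalkIn G P x v
  chain-walk             _         (Px ∷ _)   (here refl) = here Px
  chain-walk {xs = y ∷ _} (xy , ch) (Px ∷ Pxs) (there v∈) = step Px xy (chain-walk ch Pxs v∈)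

  members : List (Fin n) → Fin n → Bool
  members xs v = isYes (v ∈? xs)

  Chain⇒connected : ∀ x xs → Chain G (x ∷ xs) → ConnectedOn G (members (x ∷ xs))
  Chain⇒connected x xs ch = (x , fromWitness (here refl)) , λ u v Su Sv →
    walk-reverse (walk-from-x (toWitness Su)) ◅◅ walk-from-x (toWitness Sv)
    where
    walk-from-x : ∀ {v} → v ∈ x ∷ xs → WalkIn G (T ∘ members (x ∷ xs)) x v
    walk-from-x = chain-walk ch (All.tabulate fromWitness)

  centered⇒linear : ∀ {k c} → IsCenteredColoring G k c → IsLinearColoring G k c
  centered⇒linear cen (x ∷ xs) (_ , _ , ch) with cen (members (x ∷ xs)) (Chain⇒connected x xs ch)
  ... | v , Sv , unique = v , toWitness Sv , λ w w∈ → unique w (fromWitness w∈)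

  recolor-linear : ∀ {j k c} {f : Fin j → Fin k} → Injective _≡_ _≡_ f →
                   IsLinearColoring G j c → IsLinearColoring G k (f ∘ c)
  recolor-linear inj lin xs path with lin xs path
  ... | v , v∈ , unique = v , v∈ , λ w w∈ same → unique w w∈ (inj same)

  recolor-centered : ∀ {j k c} {f : Fin j → Fin k} → Injective _≡_ _≡_ f →
                     IsCenteredColoring G j c → IsCenteredColoring G k (f ∘ c)
  recolor-centered inj cen S conn with cen S conn
  ... | v , Sv , unique = v , Sv , λ w Sw same → unique w Sw (inj same)

  HasLinearColoring-mono : ∀ {j k} → j ≤ k → HasLinearColoring G j → HasLinearColoring G k
  HasLinearColoring-mono j≤k (c , lin) = _ , recolor-linear (inject≤-injective j≤k j≤k _ _) lin

  HasCenteredColoring-mono : ∀ {j k} → j ≤ k → HasCenteredColoring G j → HasCenteredColoring G k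
  HasCenteredColoring-mono j≤k (c , cen) = _ , recolor-centered (inject≤-injective j≤k j≤k _ _) cen

  leaf-neighbour-unique : ∀ {v a b} → IsLeaf G v → Adj G v a → Adj G v b → a ≡ b
  leaf-neighbour-unique {v} {a} {b} leaf va vb with a Finₚ.≟ b
  ... | yes a≡b = a≡b
  ... | no  a≢b = contradiction (subst (2 ≤_) leaf two-neighbours) λ { (s≤s ()) }
    where
    two-neighbours : 2 ≤ degree G v
    two-neighbours = subst₂ (λ p q → p + q ≤ degree G v) (T⇒indicator≡1 va) (T⇒indicator≡1 vb)
      (sum-map-≥-pair (λ x → if adj G v x then 1 else 0) (allFin n) a≢b (∈-allFin a) (∈-allFin b))

  adjacent-leaves-closed : ∀ {P v u x} → IsLeaf G v → IsLeaf G u → Adj G v u →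
                           WalkIn G P v x → x ≡ v ⊎ x ≡ u
  adjacent-leaves-closed {P} {v} {u} lv lu vu = from (inj₁ refl)
    where
    from : ∀ {s x} → s ≡ v ⊎ s ≡ u → WalkIn G P s x → x ≡ v ⊎ x ≡ u
    from s∈vu          (here _)       = s∈vu
    from (inj₁ refl) (step _ vw p) = from (inj₂ (leaf-neighbour-unique lv vw vu)) p
    from (inj₂ refl) (step _ uw p) = from (inj₁ (leaf-neighbour-unique lu uw (Adj-sym vu))) p

  leaves-connected : ∀ {S} → ConnectedOn G S → (∀ w → T (S w) → IsLeaf G w) →
    IsSingleton S ⊎ ∃₂ λ v u → Adj G v u × IsLeaf G v × IsLeaf G u × T (S v) × T (S u)
  leaves-connected {S} ((v , Sv) , walks) leaves with Finₚ.any? (λ w → T? (S w) ×-dec ¬? (w Finₚ.≟ v))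
  ... | yes (w , Sw , w≢v) with walks v w Sv Sw
  ...   | here _           = contradiction refl w≢v
  ...   | step {w = u} _ vu p =
          inj₂ (v , u , vu , leaves v Sv , leaves u (walk-start p) , Sv , walk-start p)
  leaves-connected {S} ((v , Sv) , walks) leaves | no none = inj₁ (v , Sv , only-v)
    where
    only-v : ∀ w → T (S w) → w ≡ v
    only-v w Sw with w Finₚ.≟ v
    ... | yes w≡v = w≡v
    ... | no  w≢v = contradiction (w , Sw , w≢v) none

  TraceIsPath : (Fin n → Set) → (Fin n → Bool) → Set
  TraceIsPath K S = ∃ λ xs → IsPath G xs × All (λ x → T (S x) × K x) xs × (∀ w → T (S w) → K w → w ∈ xs)

  leaves-trace : ∀ {S} → ConnectedOn G S → (∀ w → T (S w) → IsLeaf G w) →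
                 IsSingleton S ⊎ TraceIsPath (λ _ → ⊤) S
  leaves-trace {S} conn leaves with leaves-connected conn leaves
  ... | inj₁ single = inj₁ single
  ... | inj₂ (v , u , vu , lv , lu , Sv , Su) =
        inj₂ (v ∷ u ∷ [] , edge-path vu , (Sv , tt) ∷ (Su , tt) ∷ [] , covered)
    where
    covered : ∀ w → T (S w) → ⊤ → w ∈ v ∷ u ∷ []
    covered w Sw _ with adjacent-leaves-closed lv lu vu (proj₂ conn v w Sv Sw)
    ... | inj₁ refl = here refl
    ... | inj₂ refl = there (here refl)

  freshOutside-centered : ∀ {b c} {K : Fin n → Set} (K? : Decidable K) → IsLinearColoring G b c →
    (∀ S → ConnectedOn G S → IsSingleton S ⊎ TraceIsPath K S) →
    IsCenteredColoring G (b + 1) (freshOutside K? c)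
  freshOutside-centered {b} {c} {K} K? lin trace S conn with trace S conn
  ... | inj₁ (v , Sv , only-v) = v , Sv , λ w Sw _ → only-v w Sw
  ... | inj₂ (xs , path , in-S∩K , covers) with lin xs path
  ...   | z , z∈xs , unique = z , proj₁ (All.lookup in-S∩K z∈xs) , λ w Sw → same-color Sw (K? w)
    where
    col = freshOutside K? c
    on-z : col z ≡ c z ↑ˡ 1
    on-z = freshOutside-inside K? c (proj₂ (All.lookup in-S∩K z∈xs))
    same-color : ∀ {w} → T (S w) → Dec (K w) → col w ≡ col z → w ≡ z
    same-color Sw (yes Kw) same = unique _ (covers _ Sw Kw)
      (↑ˡ-injective 1 _ _ (trans (≡.sym (freshOutside-inside K? c Kw)) (trans same on-z)))
    same-color Sw (no ¬Kw) same = contradiction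
      (trans (≡.sym on-z) (trans (≡.sym same) (freshOutside-outside K? c ¬Kw))) (↑ˡ≢↑ʳ _ _)

  edge-colors-differ : ∀ {k c u v} → IsLinearColoring G k c → Adj G u v → c u ≢ c v
  edge-colors-differ lin uv same with lin _ (edge-path uv)
  ... | _ , here refl         , unique = Adj⇒≢ uv (≡.sym (unique _ (there (here refl)) (≡.sym same)))
  ... | _ , there (here refl) , unique = Adj⇒≢ uv (unique _ (here refl) same)

  -- The last two hypotheses say that a, b, d and b, d, e each carry at most two colors.
  P₄-needs-three-colors : ∀ {k c a b d e} → IsLinearColoring G k c → IsPath G (a ∷ b ∷ d ∷ e ∷ []) →
    (c a ≢ c b → c b ≢ c d → c a ≡ c d) → (c b ≢ c d → c d ≢ c e → c b ≡ c e) → ⊥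
  P₄-needs-three-colors lin path@(_ , (_ ∷ a≢d ∷ _) ∷ (_ ∷ b≢e ∷ _) ∷ _ , ab , bd , de , _) alt₁ alt₂ =
    alternating-P₄-no-unique a≢d b≢e
      (alt₁ (edge-colors-differ lin ab) (edge-colors-differ lin bd))
      (alt₂ (edge-colors-differ lin bd) (edge-colors-differ lin de))
      (lin _ path)

  unique-color-vertex-on-every-P₄ : ∀ {c r a b d e} → IsCenteredColoring G 3 c → (∀ w → c w ≡ c r → w ≡ r) →
                                    IsPath G (a ∷ b ∷ d ∷ e ∷ []) → All (r ≢_) (a ∷ b ∷ d ∷ e ∷ []) → ⊥
  unique-color-vertex-on-every-P₄ {c} {r} cen unique path (r≢a ∷ r≢b ∷ r≢d ∷ r≢e ∷ []) =
    P₄-needs-three-colors (centered⇒linear cen) path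
      (alternate₃-avoiding (avoids r≢a) (avoids r≢b) (avoids r≢d))
      (alternate₃-avoiding (avoids r≢b) (avoids r≢d) (avoids r≢e))
    where
    avoids : ∀ {x} → r ≢ x → c r ≢ c x
    avoids r≢x same = r≢x (≡.sym (unique _ (≡.sym same)))

-- Caterpillars

module Spine {n : ℕ} {G : Graph n} (vs : List (Fin n)) (vs-unique : Unique vs)
  (non-leaves : ∀ v → (v ∈ vs) ⇔ (¬ IsLeaf G v))
  (linked : ∀ i j → Adj G (lookup vs i) (lookup vs j) ⇔ ((toℕ i ≡ suc (toℕ j)) ⊎ (toℕ j ≡ suc (toℕ i))))
  where

  spine-or-leaf : ∀ v → v ∈ vs ⊎ IsLeaf G v
  spine-or-leaf v with degree G v ℕₚ.≟ 1
  ... | yes leaf = inj₂ leaf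
  ... | no ¬leaf = inj₁ (Equivalence.from (non-leaves v) ¬leaf)

  spine-not-leaf : ∀ {v} → v ∈ vs → ¬ IsLeaf G v
  spine-not-leaf = Equivalence.to (non-leaves _)

  off-spine-leaf : ∀ {S} → ¬ Any (T ∘ S) vs → ∀ w → T (S w) → IsLeaf G w
  off-spine-leaf misses w Sw with spine-or-leaf w
  ... | inj₁ w∈vs = contradiction (Any.map (λ { refl → Sw }) w∈vs) misses
  ... | inj₂ leaf = leaf

  spine-chain : Chain G vs
  spine-chain = consecutive⇒Chain G vs (λ i j j≡1+i → Equivalence.from (linked i j) (inj₂ j≡1+i))

  spine-separated : ∀ {L y R u w} → vs ≡ L ++ y ∷ R → u ∈ L → w ∈ R → ¬ Adj G u w
  spine-separated {L} {y} {R} refl u∈L w∈R uw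
    with index-in-prefix L (y ∷ R) u∈L | index-in-suffix L y R w∈R
  ... | i , refl , i<L | j , refl , L<j with Equivalence.to (linked i j) uw
  ... | inj₁ i≡1+j = <-asym (<-trans i<L L<j) (≤-reflexive (≡.sym i≡1+j))
  ... | inj₂ j≡1+i = <⇒≱ i<L (≤-pred (subst (length L <_) j≡1+i L<j))

  -- From L a walk steps only into L, onto y, or to a leaf hanging off L, which leads back into L.
  spine-cut : ∀ {P L y R u x} → vs ≡ L ++ y ∷ R → ¬ P y → WalkIn G P u x → u ∈ L → x ∉ R
  spine-cut {P} {L} {y} {R} split ¬Py walk u∈L x∈R = unreachable (stays (inj₁ u∈L) walk)
    where
    Reached : Fin n → Set
    Reached v = v ∈ L ⊎ (IsLeaf G v × ∃ λ m → m ∈ L × Adj G v m)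

    stays : ∀ {v x} → Reached v → WalkIn G P v x → Reached x
    stays reached (here _) = reached
    stays (inj₂ (leaf , m , m∈L , vm)) (step _ vw p) =
      stays (inj₁ (subst (_∈ L) (leaf-neighbour-unique G leaf vm vw) m∈L)) p
    stays {v} (inj₁ v∈L) (step {w = w} _ vw p) = stays (next (spine-or-leaf w)) p
      where
      next : w ∈ vs ⊎ IsLeaf G w → Reached w
      next (inj₂ leaf) = inj₂ (leaf , v , v∈L , Adj-sym G vw)
      next (inj₁ w∈vs) with ∈-++⁻ L (subst (w ∈_) split w∈vs)
      ... | inj₁ w∈L         = inj₁ w∈L
      ... | inj₂ (here refl) = contradiction (walk-start G p) ¬Py
      ... | inj₂ (there w∈R) = contradiction vw (spine-separated split v∈L w∈R)

    unreachable : Reached _ → ⊥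
    unreachable (inj₁ x∈L) = Unique-++-disjoint L (subst Unique split vs-unique) x∈L (there x∈R)
    unreachable (inj₂ (leaf , _)) = spine-not-leaf (subst (_ ∈_) (≡.sym split) (∈-++⁺ʳ L (there x∈R))) leaf

  spine-trace : ∀ {S} → ConnectedOn G S → Any (T ∘ S) vs → TraceIsPath G (_∈ vs) S
  spine-trace {S} (_ , walks) meets = first ∷ rest , run-path , in-S∩vs , covers
    where
    open FirstRun (first-run (T? ∘ S) vs meets)

    run-path : IsPath G (first ∷ rest)
    run-path = s≤s z≤n
             , Unique-++⁻ˡ (first ∷ rest) (Unique-++⁻ʳ before (subst Unique split vs-unique))
             , Chain-++⁻ˡ G (first ∷ rest) (Chain-++⁻ʳ G before (subst (Chain G) split spine-chain))

    in-S∩vs : All (λ x → T (S x) × x ∈ vs) (first ∷ rest)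
    in-S∩vs = All.tabulate λ x∈ →
      All.lookup run-P x∈ , subst (_ ∈_) (≡.sym split) (∈-++⁺ʳ before (∈-++⁺ˡ x∈))

    not-after : ∀ {w} → T (S w) → ∀ after′ → Maybe.All (∁ (T ∘ S)) (head after′) →
                vs ≡ before ++ (first ∷ rest) ++ after′ → w ∉ after′
    not-after Sw (y ∷ R) (Maybe.just ¬Sy) split′ (here refl)  = ¬Sy Sw
    not-after Sw (y ∷ R) (Maybe.just ¬Sy) split′ (there w∈R) =
      spine-cut (trans split′ (≡.sym (++-assoc before (first ∷ rest) (y ∷ R)))) ¬Sy
        (walks first _ (All.lookup run-P (here refl)) Sw) (∈-++⁺ʳ before (here refl)) w∈R

    covers : ∀ w → T (S w) → w ∈ vs → w ∈ first ∷ rest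
    covers w Sw w∈vs with ∈-++⁻ before (subst (w ∈_) split w∈vs)
    ... | inj₁ w∈before = contradiction Sw (All.lookup before-∁P w∈before)
    ... | inj₂ w∈run++after with ∈-++⁻ (first ∷ rest) w∈run++after
    ...   | inj₁ w∈run   = w∈run
    ...   | inj₂ w∈after = contradiction w∈after (not-after Sw after after-head split)

  off-spine-singleton : ∀ {h S} → h ∈ vs → Connected G → ConnectedOn G S → ¬ Any (T ∘ S) vs → IsSingleton S
  off-spine-singleton {h} h∈vs (_ , walks) connS misses
    with leaves-connected G connS (off-spine-leaf misses)
  ... | inj₁ single = single
  ... | inj₂ (v , u , vu , lv , lu , _) with adjacent-leaves-closed G lv lu vu (walks v h tt tt)
  ...   | inj₁ refl = ⊥-elim (spine-not-leaf h∈vs lv)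
  ...   | inj₂ refl = ⊥-elim (spine-not-leaf h∈vs lu)

caterpillar-centered : ∀ {n} {G : Graph n} {b} → IsCaterpillar G →
                       HasLinearColoring G b → HasCenteredColoring G (b + 1)
caterpillar-centered {G = G} ((_ , conn , _) , [] , uq , non-leaves , linked) (c , lin) =
  freshOutside everything c , freshOutside-centered G everything lin
    λ S connS → leaves-trace G connS (off-spine-leaf (λ ()))
  where
  open Spine {G = G} [] uq non-leaves linked
  everything : Decidable {A = Fin _} (λ _ → ⊤)
  everything _ = yes tt
caterpillar-centered {n} {G} ((_ , conn , _) , vs@(h ∷ _) , uq , non-leaves , linked) (c , lin) =
  freshOutside (_∈? vs) c , freshOutside-centered G (_∈? vs) lin trace
  where
  open Spine vs uq non-leaves linked
  open DecMembership (Finₚ._≟_ {n}) using (_∈?_)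
  trace : ∀ S → ConnectedOn G S → IsSingleton S ⊎ TraceIsPath G (_∈ vs) S
  trace S connS with any? (T? ∘ S) vs
  ... | yes meets = inj₂ (spine-trace connS meets)
  ... | no misses = inj₁ (off-spine-singleton (here refl) conn connS misses)

-- Enumerating paths

module _ {n : ℕ} (G : Graph n) where

  open DecMembership (Finₚ._≟_ {n}) using (_∈?_)

  chain? : Decidable (Chain G)
  chain? []           = yes tt
  chain? (x ∷ [])     = yes tt
  chain? (x ∷ y ∷ xs) = T? (adj G x y) ×-dec chain? (y ∷ xs)

  isPath? : Decidable (IsPath G)
  isPath? xs = (1 ≤? length xs) ×-dec allPairs? (λ x y → ¬? (x Finₚ.≟ y)) xs ×-dec chain? xs

  extensions : List (Fin n) → List (List (Fin n))
  extensions []         = []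
  extensions p@(x ∷ _) = map (_∷ p) (filter (λ y → T? (adj G y x) ×-dec ¬? (y ∈? p)) (allFin n))

  paths : ℕ → List (List (Fin n))
  paths zero          = []
  paths (suc zero)    = map [_] (allFin n)
  paths (suc (suc k)) = concatMap extensions (paths (suc k))

  paths-complete : ∀ xs → IsPath G xs → xs ∈ paths (length xs)
  paths-complete (x ∷ [])     _                           = ∈-map⁺ [_] (∈-allFin x)
  paths-complete (y ∷ x ∷ p) (_ , y∉ ∷ uq , yx , ch) = ∈-concatMap⁺ extensions (Any.map extend
    (paths-complete (x ∷ p) (s≤s z≤n , uq , ch)))
    where
    extend : ∀ {q} → x ∷ p ≡ q → y ∷ x ∷ p ∈ extensions q
    extend refl = ∈-map⁺ (_∷ x ∷ p) (∈-filter⁺ _ (∈-allFin y) (yx , All¬⇒¬Any y∉))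

  paths-vanish : ∀ k m → paths (suc k) ≡ [] → paths (suc k + m) ≡ []
  paths-vanish k zero    none = subst (λ j → paths (suc j) ≡ []) (≡.sym (+-identityʳ k)) none
  paths-vanish k (suc m) none = subst (λ j → paths (suc j) ≡ []) (≡.sym (+-suc k m))
    (cong (concatMap extensions) (paths-vanish k m none))

  path-length-< : ∀ {k xs} → paths (suc k) ≡ [] → IsPath G xs → length xs < suc k
  path-length-< {k} {xs} none path with length xs ≤? k
  ... | yes ≤k = s≤s ≤k
  ... | no  ≰k = contradiction (subst (xs ∈_) vanished (paths-complete xs path)) λ ()
    where
    vanished : paths (length xs) ≡ []
    vanished = trans (cong paths (≡.sym (m+[n∸m]≡n (≰⇒> ≰k)))) (paths-vanish k _ none)

  all-paths : ∀ {Q : List (Fin n) → Set} k → paths (suc k) ≡ [] →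
              (∀ (j : Fin (suc k)) → All Q (paths (toℕ j))) → ∀ xs → IsPath G xs → Q xs
  all-paths k none checked xs path = All.lookup (checked (fromℕ< shorter))
    (subst (λ ℓ → xs ∈ paths ℓ) (≡.sym (toℕ-fromℕ< shorter)) (paths-complete xs path))
    where shorter = path-length-< none path

  closesUp : List (Fin n) → Bool
  closesUp (x ∷ _ ∷ zs) = maybe′ (λ z → adj G z x) false (last zs)
  closesUp _            = false

  no-closing-path⇒acyclic : (∀ xs → IsPath G xs → closesUp xs ≡ false) → ¬ HasCycle G
  no-closing-path⇒acyclic open-paths (x , y ∷ ys , z , _ , uq , ch , zx) = subst T zx-absent zx
    where
    zx-absent : adj G z x ≡ false
    zx-absent = trans (cong (maybe′ (λ z → adj G z x) false) (≡.sym (last-∷ʳ ys z)))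
                      (open-paths _ (s≤s z≤n , uq , ch))

-- The comb

pattern v0 = zero
pattern v1 = suc v0
pattern v2 = suc v1
pattern v3 = suc v2
pattern v4 = suc v3
pattern v5 = suc v4
pattern v6 = suc v5
pattern v7 = suc v6

combEdge : Fin 8 → Fin 8 → Bool
combEdge v0 v1 = true
combEdge v1 v2 = true
combEdge v2 v3 = true
combEdge v0 v4 = true
combEdge v1 v5 = true
combEdge v2 v6 = true
combEdge v3 v7 = true
combEdge _  _  = false

Comb : Graph 8
Comb = record
  { adj    = λ u v → combEdge u v ∨ combEdge v u
  ; sym    = λ u v → ∨-comm (combEdge u v) (combEdge v u)
  ; irrefl = λ { v0 → refl ; v1 → refl ; v2 → refl ; v3 → refl
               ; v4 → refl ; v5 → refl ; v6 → refl ; v7 → refl }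
  }

comb-path : ∀ xs → {True (isPath? Comb xs)} → IsPath Comb xs
comb-path xs {p} = toWitness p

comb-connected : Connected Comb
comb-connected = (v0 , tt) , λ u v _ _ → _◅◅_ Comb (to-v1 u) (walk-reverse Comb (to-v1 v))
  where
  to-v1 : ∀ x → WalkIn Comb (λ _ → ⊤) x v1
  to-v1 v0 = step tt tt (here tt)
  to-v1 v1 = here tt
  to-v1 v2 = step tt tt (here tt)
  to-v1 v3 = step {w = v2} tt tt (step tt tt (here tt))
  to-v1 v4 = step {w = v0} tt tt (step tt tt (here tt))
  to-v1 v5 = step tt tt (here tt)
  to-v1 v6 = step {w = v2} tt tt (step tt tt (here tt))
  to-v1 v7 = step {w = v3} tt tt (step {w = v2} tt tt (step tt tt (here tt)))

combSpine : List (Fin 8)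
combSpine = v0 ∷ v1 ∷ v2 ∷ v3 ∷ []

-- The longest paths of the comb have six vertices, so `paths Comb 7` computes to [].
comb-acyclic : ¬ HasCycle Comb
comb-acyclic = no-closing-path⇒acyclic Comb (all-paths Comb 6 refl
  (toWitness {a? = Finₚ.all? λ j → all? (λ xs → closesUp Comb xs Boolₚ.≟ false) (paths Comb (toℕ j))} tt))

comb-caterpillar : IsCaterpillar Comb
comb-caterpillar = (s≤s z≤n , comb-connected , comb-acyclic)
  , combSpine , proj₁ (proj₂ (comb-path combSpine))
  , (λ v → uncurry mk⇔ (non-leaves v)) , (λ i j → uncurry mk⇔ (linked i j))
  where
  open DecMembership (Finₚ._≟_ {8}) using (_∈?_)
  non-leaves = toWitness {a? = Finₚ.all? λ v →
    let non-leaf? = ¬? (degree Comb v ℕₚ.≟ 1)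
    in ((v ∈? combSpine) →-dec non-leaf?) ×-dec (non-leaf? →-dec (v ∈? combSpine))} tt
  linked = toWitness {a? = Finₚ.all? λ i → Finₚ.all? λ j →
    let consecutive? = (toℕ i ℕₚ.≟ suc (toℕ j)) ⊎-dec (toℕ j ℕₚ.≟ suc (toℕ i))
        adjacent? = T? (adj Comb (lookup combSpine i) (lookup combSpine j))
    in (adjacent? →-dec consecutive?) ×-dec (consecutive? →-dec adjacent?)} tt

comb3Coloring : Fin 8 → Fin 3
comb3Coloring v0 = zero
comb3Coloring v1 = suc zero
comb3Coloring v2 = suc (suc zero)
comb3Coloring v3 = zero
comb3Coloring v4 = suc zero
comb3Coloring v5 = suc (suc zero)
comb3Coloring v6 = zero
comb3Coloring v7 = suc zero

comb-3-linear : IsLinearColoring Comb 3 comb3Coloring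
comb-3-linear = all-paths Comb 6 refl (toWitness {a? = Finₚ.all? λ j →
  all? (uniqueColorIn? Finₚ._≟_ Finₚ._≟_ comb3Coloring) (paths Comb (toℕ j))} tt)

comb-no-linear-2-coloring : ¬ HasLinearColoring Comb 2
comb-no-linear-2-coloring (_ , lin) =
  P₄-needs-three-colors Comb lin (comb-path combSpine) alternate₂ alternate₂

combLeftP₄ combRightP₄ : List (Fin 8)
combLeftP₄  = v4 ∷ v0 ∷ v1 ∷ v5 ∷ []
combRightP₄ = v6 ∷ v2 ∷ v3 ∷ v7 ∷ []

misses-a-comb-P₄ : ∀ r → All (r ≢_) combLeftP₄ ⊎ All (r ≢_) combRightP₄
misses-a-comb-P₄ = toWitness {a? = Finₚ.all? λ r → avoids? r combLeftP₄ ⊎-dec avoids? r combRightP₄} tt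
  where avoids? = λ r → all? (λ x → ¬? (r Finₚ.≟ x))

comb-no-centered-3-coloring : ¬ HasCenteredColoring Comb 3
comb-no-centered-3-coloring (_ , cen) with cen (λ _ → true) comb-connected
... | r , _ , unique = avoided (misses-a-comb-P₄ r)
  where
  avoided : All (r ≢_) combLeftP₄ ⊎ All (r ≢_) combRightP₄ → ⊥
  avoided (inj₁ misses-left)  =
    unique-color-vertex-on-every-P₄ Comb cen (λ w → unique w tt) (comb-path combLeftP₄) misses-left
  avoided (inj₂ misses-right) =
    unique-color-vertex-on-every-P₄ Comb cen (λ w → unique w tt) (comb-path combRightP₄) misses-right

comb-χ-lin : IsChiLin Comb 3
comb-χ-lin = (comb3Coloring , comb-3-linear) ,
  λ _ → upward-closed-fails⇒< (HasLinearColoring-mono Comb) comb-no-linear-2-coloring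

comb-χ-cen : IsChiCen Comb 4
comb-χ-cen = caterpillar-centered comb-caterpillar (proj₁ comb-χ-lin) ,
  λ _ → upward-closed-fails⇒< (HasCenteredColoring-mono Comb) comb-no-centered-3-coloring

theorem4p8 : (∀ {n} (T : Graph n) → IsCaterpillar T →
    ∀ a b → IsChiCen T a → IsChiLin T b → a ≤ b + 1)
    × (Σ ℕ λ n → Σ (Graph n) λ T → IsCaterpillar T ×
    (Σ ℕ λ a → Σ ℕ λ b → IsChiCen T a × IsChiLin T b × a ≡ b + 1))
theorem4p8 = upper-bound , 8 , Comb , comb-caterpillar , 4 , 3 , comb-χ-cen , comb-χ-lin , refl
  where
  upper-bound : ∀ {n} (T : Graph n) → IsCaterpillar T → ∀ a b → IsChiCen T a → IsChiLin T b → a ≤ b + 1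
  upper-bound T cat a b (_ , least) (lin , _) = least (b + 1) (caterpillar-centered cat lin)
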